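{- Let $t$ be a positive integer and let $G$ be a graph on $n$ vertices with minimum degree $\delta(G) \geq \frac{2n-2t-1}{t+1}$, whose edges are coloured with two colours. Then the vertex set of $G$ can be covered by at most $t$ monochromatic components.
   Context: A $2$-coloured graph is a graph whose edges are each assigned one of two colours (red and blue). A red component is the vertex set of a connected component of the spanning subgraph of $G$ with vertex set $V(G)$ and edge set the red edges of $G$ (so a vertex incident with no red edges forms a red component by itself); blue components are defined analogously. A monochromatic component is a red or blue component. Covering means the union of the chosen components equals $V(G)$. -}

module Defs where

open import Data.Nat using (ℕ; zero; suc; _+_; _*_; _≤_)
open import Data.Bool using (Bool; true; false; if_then_else_)
open import Data.Fin using (Fin)
open import Data.List using (List; length; allFin; filter)
open import Data.List.Membership.Propositional using (_∈_)
open import Data.Product using (Σ; _×_; _,_; ∃-syntax)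
open import Relation.Binary.PropositionalEquality using (_≡_)
open import Relation.Nullary using (Dec)
open import Data.Bool using (T?; T)

record Graph (n : ℕ) : Set where
  field
    adj   : Fin n → Fin n → Bool
    sym   : ∀ u v → adj u v ≡ adj v u
    irrefl : ∀ v → adj v v ≡ false
open Graph public

data Colour : Set where
  red blue : Colour

-- A 2-colouring of the edges: a symmetric assignment of a colour to each pair
-- (only its values on edges matter).
record TwoColouring {n : ℕ} (G : Graph n) : Set where
  field
    col    : Fin n → Fin n → Colour
    colSym : ∀ u v → col u v ≡ col v u
open TwoColouring public

degree : ∀ {n} → Graph n → Fin n → ℕ
degree {n} G v = length (filter (λ u → T? (adj G v u)) (allFin n))

data Reach {n : ℕ} (G : Graph n) (χ : TwoColouring G) (c : Colour) (r : Fin n) : Fin n → Set where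
  here : Reach G χ c r r
  step : ∀ {u w} → Reach G χ c r u → adj G u w ≡ true → col χ u w ≡ c → Reach G χ c r w

Component : ∀ {n} (G : Graph n) (χ : TwoColouring G) → Colour → Fin n → Fin n → Set
Component G χ c r v = Reach G χ c r v

CoverableBy : ∀ {n} (G : Graph n) (χ : TwoColouring G) → ℕ → Set
CoverableBy {n} G χ t =
  Σ (List (Colour × Fin n)) λ L →
    (length L ≤ t) × (∀ v → ∃[ c ] ∃[ r ] (((c , r) ∈ L) × Component G χ c r v))

-- Reading each vertex as an edge between its red and its blue component turns the monochromatic
-- components into the vertices of a bipartite multigraph, covers by components into vertex covers,
-- and sets of vertices no two of which share a component ("independent" sets) into matchings.  By
-- König's theorem some cover uses no more components than some independent set has vertices.  An
-- independent set S cannot have t + 1 vertices: every vertex w lies in at most one red and one blue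
-- component meeting S, so counting the pairs (v , w) with v ∈ S and w equal (twice) or adjacent to v
-- gives Σ_{v ∈ S} (deg v + 2) ≤ 2n, against the degree bound.
module Submission where

open import Defs renaming (sym to adj-sym)
open import Data.Bool using (true; false; T?)
import Data.Bool.Properties as Bool
open import Data.Empty using (⊥; ⊥-elim)
open import Data.Fin using (Fin) renaming (_≟_ to _≟ᶠ_)
import Data.Fin.Properties as Fin
open import Data.List using (List; []; _∷_; length; filter; allFin; map; take; deduplicate)
open import Data.List.Membership.Propositional using (_∈_; lose; find)
open import Data.List.Membership.Propositional.Properties using (∈-filter⁺; ∈-filter⁻; ∈-allFin; ∈-deduplicate⁻)
open import Data.List.Properties using (length-map; length-take; length-tabulate; length-deduplicate; filter-notAll)
open import Data.List.Relation.Binary.Subset.Propositional using (_⊆_)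
import Data.List.Relation.Unary.All as All
open import Data.List.Relation.Unary.All.Properties using (all-filter)
open import Data.List.Relation.Unary.AllPairs using (AllPairs; []; _∷_)
import Data.List.Relation.Unary.AllPairs.Properties as AllPairs
open import Data.List.Relation.Unary.Any as Any using (Any; here; there; any?)
import Data.List.Relation.Unary.Any.Properties as Any
open import Data.List.Relation.Unary.Unique.Propositional.Properties using (allFin⁺)
open import Data.Nat using (ℕ; zero; suc; _+_; _*_; _≤_; _<_; z≤n; s≤s; s≤s⁻¹; _≟_; _≤?_)
open import Data.Nat.Properties
open import Data.Nat.Induction using (<-wellFounded)
open import Algebra.Properties.CommutativeSemigroup +-commutativeSemigroup using (interchange)
open import Data.Product using (_×_; _,_; proj₁; proj₂; ∃-syntax)
open import Data.Sum using (_⊎_; inj₁; inj₂)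
open import Function using (_∘_; _on_; id)
open import Induction.WellFounded using (WfRec)
import Induction.WellFounded as WellFounded
open import Level using (Level; 0ℓ)
open import Relation.Binary using (Rel; Decidable; IsEquivalence)
open import Relation.Binary.Construct.Closure.ReflexiveTransitive using (Star; ε; _◅_; _◅◅_)
import Relation.Binary.Construct.On as On
open import Relation.Binary.PropositionalEquality using (_≡_; _≢_; refl; sym; trans; cong; cong₂; module ≡-Reasoning)
open import Relation.Nullary using (Dec; yes; no; ¬_; ¬?)
open import Relation.Nullary.Decidable using (_×-dec_; _⊎-dec_; map′; decidable-stable)
open import Relation.Unary using (Pred) renaming (Decidable to Decidable₁)

private variable
  p q s : Level
  A B : Set

∑ : List A → (A → ℕ) → ℕ
∑ []       f = 0
∑ (x ∷ xs) f = f x + ∑ xs f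

syntax ∑ xs (λ x → e) = ∑[ x ← xs ] e

module _ {f g : A → ℕ} where

  ∑-mono : ∀ xs → (∀ {x} → x ∈ xs → f x ≤ g x) → ∑ xs f ≤ ∑ xs g
  ∑-mono []       _ = z≤n
  ∑-mono (x ∷ xs) h = +-mono-≤ (h (here refl)) (∑-mono xs (h ∘ there))

  ∑-mono-< : ∀ xs → (∀ {x} → x ∈ xs → f x ≤ g x) → ∀ {x} → x ∈ xs → f x < g x → ∑ xs f < ∑ xs g
  ∑-mono-< (y ∷ xs) h (here refl) lt = +-mono-<-≤ lt (∑-mono xs (h ∘ there))
  ∑-mono-< (y ∷ xs) h (there x∈) lt = +-mono-≤-< (h (here refl)) (∑-mono-< xs (h ∘ there) x∈ lt)

  ∑-cong : ∀ xs → (∀ {x} → x ∈ xs → f x ≡ g x) → ∑ xs f ≡ ∑ xs g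
  ∑-cong []       _ = refl
  ∑-cong (x ∷ xs) h = cong₂ _+_ (h (here refl)) (∑-cong xs (h ∘ there))

  ∑-+ : ∀ xs → ∑[ x ← xs ] (f x + g x) ≡ ∑ xs f + ∑ xs g
  ∑-+ []       = refl
  ∑-+ (x ∷ xs) rewrite ∑-+ xs = interchange (f x) (g x) (∑ xs f) (∑ xs g)

∑-const : ∀ (xs : List A) k → ∑[ x ← xs ] k ≡ length xs * k
∑-const []       k = refl
∑-const (x ∷ xs) k = cong (k +_) (∑-const xs k)

∑-*ˡ : ∀ (xs : List A) k (f : A → ℕ) → ∑[ x ← xs ] (k * f x) ≡ k * ∑ xs f
∑-*ˡ []       k f = sym (*-zeroʳ k)
∑-*ˡ (x ∷ xs) k f rewrite ∑-*ˡ xs k f = sym (*-distribˡ-+ k (f x) (∑ xs f))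

∑-comm : ∀ (xs : List A) (ys : List B) (f : A → B → ℕ) →
         ∑[ x ← xs ] ∑ ys (f x) ≡ ∑[ y ← ys ] ∑[ x ← xs ] f x y
∑-comm []       ys f = sym (trans (∑-const ys 0) (*-zeroʳ (length ys)))
∑-comm (x ∷ xs) ys f rewrite ∑-comm xs ys f = sym (∑-+ ys)

∑1≡length : ∀ (xs : List A) → ∑[ x ← xs ] 1 ≡ length xs
∑1≡length xs = trans (∑-const xs 1) (*-identityʳ _)

indicator : {P : Set p} → Dec P → ℕ
indicator (yes _) = 1
indicator (no _)  = 0

indicator-mono : {P : Set p} {Q : Set q} (P? : Dec P) (Q? : Dec Q) → (P → Q) → indicator P? ≤ indicator Q?
indicator-mono (yes p) (yes _) _ = ≤-refl
indicator-mono (yes p) (no ¬q) f = ⊥-elim (¬q (f p))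
indicator-mono (no _)  _       _ = z≤n

indicator-cong : {P : Set p} {Q : Set q} (P? : Dec P) (Q? : Dec Q) → (P → Q) → (Q → P) →
                 indicator P? ≡ indicator Q?
indicator-cong P? Q? f g = ≤-antisym (indicator-mono P? Q? f) (indicator-mono Q? P? g)

indicator-⊎ : {P : Set p} {Q : Set q} {S : Set s} (P? : Dec P) (Q? : Dec Q) (S? : Dec S) →
              (P → Q ⊎ S) → indicator P? ≤ indicator Q? + indicator S?
indicator-⊎ (no _)  _  _  _ = z≤n
indicator-⊎ (yes p) Q? S? f with f p
... | inj₁ q = ≤-trans (indicator-mono (yes p) Q? (λ _ → q)) (m≤m+n _ _)
... | inj₂ s = ≤-trans (indicator-mono (yes p) S? (λ _ → s)) (m≤n+m _ _)

indicator≤1 : {P : Set p} (P? : Dec P) → indicator P? ≤ 1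
indicator≤1 (yes _) = ≤-refl
indicator≤1 (no _)  = z≤n

count : {P : Pred A p} → Decidable₁ P → List A → ℕ
count P? xs = ∑[ x ← xs ] indicator (P? x)

module _ {P : Pred A p} (P? : Decidable₁ P) where

  count≡length-filter : ∀ xs → count P? xs ≡ length (filter P? xs)
  count≡length-filter []       = refl
  count≡length-filter (x ∷ xs) with P? x
  ... | yes _ = cong suc (count≡length-filter xs)
  ... | no  _ = count≡length-filter xs

  count≤length : ∀ xs → count P? xs ≤ length xs
  count≤length xs = begin
    count P? xs    ≤⟨ ∑-mono xs (λ {x} _ → indicator≤1 (P? x)) ⟩
    ∑[ x ← xs ] 1  ≡⟨ ∑1≡length xs ⟩
    length xs      ∎
    where open ≤-Reasoning

  count≡0 : ∀ xs → (∀ {x} → x ∈ xs → ¬ P x) → count P? xs ≡ 0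
  count≡0 []       _ = refl
  count≡0 (x ∷ xs) h with P? x
  ... | yes px = ⊥-elim (h (here refl) px)
  ... | no  _  = count≡0 xs (h ∘ there)

  count≥1 : ∀ {xs} → Any P xs → 1 ≤ count P? xs
  count≥1 {x ∷ xs} (here px) with P? x
  ... | yes _  = s≤s z≤n
  ... | no ¬px = ⊥-elim (¬px px)
  count≥1 {x ∷ xs} (there a) = ≤-trans (count≥1 a) (m≤n+m _ _)

  count≥2 : ∀ {xs x y} → x ∈ xs → y ∈ xs → x ≢ y → P x → P y → 2 ≤ count P? xs
  count≥2 (here refl) (here refl) x≢y _  _  = ⊥-elim (x≢y refl)
  count≥2 {z ∷ xs} (here refl) (there y∈) _ px py with P? z
  ... | yes _  = s≤s (count≥1 (lose y∈ py))
  ... | no ¬px = ⊥-elim (¬px px)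
  count≥2 {z ∷ xs} (there x∈) (here refl) _ px py with P? z
  ... | yes _  = s≤s (count≥1 (lose x∈ px))
  ... | no ¬py = ⊥-elim (¬py py)
  count≥2 (there x∈) (there y∈) x≢y px py = ≤-trans (count≥2 x∈ y∈ x≢y px py) (m≤n+m _ _)

  count≤1 : {Q : Rel A q} → (∀ {x y} → P x → P y → ¬ Q x y) → ∀ {xs} → AllPairs Q xs → count P? xs ≤ 1
  count≤1 _ [] = z≤n
  count≤1 apart {x ∷ xs} (qx ∷ qs) with P? x
  ... | no  _  = count≤1 apart qs
  ... | yes px = ≤-reflexive (cong suc (count≡0 xs (λ y∈ py → apart px py (All.lookup qx y∈))))

module _ {P : Pred A p} {Q : Pred A q} (P? : Decidable₁ P) (Q? : Decidable₁ Q) where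

  count-mono-< : ∀ xs → (∀ {x} → P x → Q x) → ∀ {x} → x ∈ xs → ¬ P x → Q x → count P? xs < count Q? xs
  count-mono-< xs P⊆Q {x} x∈ ¬px qx = ∑-mono-< xs (λ {y} _ → indicator-mono (P? y) (Q? y) P⊆Q) x∈
    (≤-trans (s≤s (indicator-mono (P? x) (no ¬px) (λ px → px))) (indicator-mono (yes qx) (Q? x) (λ _ → qx)))

  count-⊎ : {S : Pred A s} (S? : Decidable₁ S) → ∀ xs → (∀ {x} → x ∈ xs → P x → Q x ⊎ S x) →
            count P? xs ≤ count Q? xs + count S? xs
  count-⊎ S? xs h = begin
    count P? xs                                    ≤⟨ ∑-mono xs (λ {x} x∈ → indicator-⊎ (P? x) (Q? x) (S? x) (h x∈)) ⟩
    ∑[ x ← xs ] (indicator (Q? x) + indicator (S? x)) ≡⟨ ∑-+ xs ⟩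
    count Q? xs + count S? xs                      ∎
    where open ≤-Reasoning

deduplicate-apart : {R : Rel A q} (R? : Decidable R) → ∀ xs → AllPairs (λ x y → ¬ R x y) (deduplicate R? xs)
deduplicate-apart R? []       = []
deduplicate-apart R? (x ∷ xs) =
  all-filter (¬? ∘ R? x) (deduplicate R? xs) ∷ AllPairs.filter⁺ (¬? ∘ R? x) (deduplicate-apart R? xs)

-- The vertices reachable from r in at most k steps grow strictly until they are closed under E,
-- so after n + 1 rounds they are closed, hence contain every vertex reachable from r.
module _ {n : ℕ} {E : Rel (Fin n) 0ℓ} (E? : Decidable E) (r : Fin n) where

  private
    Within : ℕ → Pred (Fin n) 0ℓ
    Within zero    w = r ≡ w
    Within (suc k) w = Within k w ⊎ ∃[ u ] Within k u × E u w

    within? : ∀ k → Decidable₁ (Within k)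
    within? zero    w = r ≟ᶠ w
    within? (suc k) w = within? k w ⊎-dec Fin.any? (λ u → within? k u ×-dec E? u w)

    within-start : ∀ k → Within k r
    within-start zero    = refl
    within-start (suc k) = inj₁ (within-start k)

    within⇒star : ∀ k {w} → Within k w → Star E r w
    within⇒star zero    refl               = ε
    within⇒star (suc k) (inj₁ w∈)          = within⇒star k w∈
    within⇒star (suc k) (inj₂ (u , u∈ , e)) = within⇒star k u∈ ◅◅ (e ◅ ε)

    Closed : ℕ → Set
    Closed k = ∀ {u w} → Within k u → E u w → Within k w

    Escape : ℕ → Set
    Escape k = ∃[ u ] ∃[ w ] Within k u × E u w × ¬ Within k w

    escape? : ∀ k → Dec (Escape k)
    escape? k = Fin.any? λ u → Fin.any? λ w → within? k u ×-dec E? u w ×-dec ¬? (within? k w)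

    closed-suc : ∀ k → Closed k → Closed (suc k)
    closed-suc k closed u∈ e = inj₁ (closed (shrink u∈) e)
      where
      shrink : ∀ {v} → Within (suc k) v → Within k v
      shrink (inj₁ v∈)           = v∈
      shrink (inj₂ (_ , u∈ , e)) = closed u∈ e

    size : ℕ → ℕ
    size k = count (within? k) (allFin n)

    closed-or-large : ∀ k → Closed k ⊎ k ≤ size k
    closed-or-large zero = inj₂ z≤n
    closed-or-large (suc k) with closed-or-large k
    ... | inj₁ closed = inj₁ (closed-suc k closed)
    ... | inj₂ large with escape? k
    ... | yes (u , w , u∈ , e , w∉) =
      inj₂ (≤-trans (s≤s large) (count-mono-< (within? k) (within? (suc k)) (allFin n) inj₁
                                                (∈-allFin w) w∉ (inj₂ (u , u∈ , e))))
    ... | no noEscape = inj₁ (closed-suc k closed)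
      where
      closed : Closed k
      closed {u} {w} u∈ e = decidable-stable (within? k w) (λ w∉ → noEscape (u , w , u∈ , e , w∉))

    saturated : Closed (suc n)
    saturated with closed-or-large (suc n)
    ... | inj₁ closed = closed
    ... | inj₂ large  = ⊥-elim (<⇒≱ (s≤s bounded) large)
      where
      bounded : size (suc n) ≤ n
      bounded = ≤-trans (count≤length (within? (suc n)) (allFin n)) (≤-reflexive (length-tabulate id))

    star⇒within : ∀ {u w} → Within (suc n) u → Star E u w → Within (suc n) w
    star⇒within u∈ ε       = u∈
    star⇒within u∈ (e ◅ s) = star⇒within (saturated u∈ e) s

  star? : Decidable₁ (Star E r)
  star? w = map′ (within⇒star (suc n)) (star⇒within (within-start (suc n))) (within? (suc n) w)

other : Colour → Colour
other red  = blue
other blue = red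

same-or-other : ∀ c d → d ≡ c ⊎ d ≡ other c
same-or-other red  red  = inj₁ refl
same-or-other red  blue = inj₂ refl
same-or-other blue red  = inj₂ refl
same-or-other blue blue = inj₁ refl

-- Rizzi's proof of König's theorem, for the multigraph whose vertices are the classes of R red and
-- R blue and whose edges are the elements of X.
module König {X : Set} (R : Colour → Rel X 0ℓ) (R? : ∀ c → Decidable (R c))
             (R-equivalence : ∀ c → IsEquivalence (R c)) where

  private
    R-refl : ∀ c {x} → R c x x
    R-refl c = IsEquivalence.refl (R-equivalence c)

    R-sym : ∀ c {x y} → R c x y → R c y x
    R-sym c = IsEquivalence.sym (R-equivalence c)

    R-trans : ∀ c {x y z} → R c x y → R c y z → R c x z
    R-trans c = IsEquivalence.trans (R-equivalence c)

  Independent : Rel X 0ℓ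
  Independent x y = ∀ c → ¬ R c x y

  Parallel : Rel X 0ℓ
  Parallel x y = ∀ c → R c x y

  parallel? : Decidable Parallel
  parallel? x y = map′ (λ (r , b) → λ { red → r ; blue → b }) (λ par → par red , par blue)
                       (R? red x y ×-dec R? blue x y)

  parallel-from : ∀ c {x y} → R c x y → R (other c) x y → Parallel x y
  parallel-from c h h′ d with same-or-other c d
  ... | inj₁ refl = h
  ... | inj₂ refl = h′

  NonParallel : List X → Set
  NonParallel = AllPairs (λ x y → ¬ Parallel x y)

  Class : Set
  Class = Colour × X

  _covers_ : Class → X → Set
  (c , r) covers u = R c r u

  covers? : ∀ p → Decidable₁ (p covers_)
  covers? (c , r) = R? c r

  Covers : List Class → X → Set
  Covers C u = Any (_covers u) C

  covers-parallel : ∀ {C u v} → Covers C u → Parallel u v → Covers C v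
  covers-parallel cov par = Any.map (λ {(c , _)} h → R-trans c h (par c)) cov

  classSize : List X → Class → ℕ
  classSize D p = count (covers? p) D

  Uniform : List X → ℕ → Set
  Uniform D k = ∀ c {x} → x ∈ D → classSize D (c , x) ≡ k

  record KönigPair (U : List X) : Set where
    field
      matching       : List X
      cover          : List Class
      matching⊆      : matching ⊆ U
      independent    : AllPairs Independent matching
      covers         : ∀ {u} → u ∈ U → Covers cover u
      cover≤matching : length cover ≤ length matching

  Below : List X → Set
  Below U = WfRec (_<_ on length) KönigPair U

  _∖_ : List X → Class → List X
  D ∖ p = filter (¬? ∘ covers? p) D

  _∖∥_ : List X → X → List X
  D ∖∥ f = filter (λ x → ¬? (parallel? x f)) D

  ∖-shorter : ∀ {D e} c → e ∈ D → length (D ∖ (c , e)) < length D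
  ∖-shorter {D} c e∈ = filter-notAll (¬? ∘ covers? _) D (lose e∈ (λ e∉ → e∉ (R-refl c)))

  ∖∥-shorter : ∀ {D f} → f ∈ D → length (D ∖∥ f) < length D
  ∖∥-shorter {D} f∈ = filter-notAll (λ x → ¬? (parallel? x _)) D (lose f∈ (λ f∉ → f∉ (λ c → R-refl c)))

  ∈-∖⁺ : ∀ {D p x} → x ∈ D → ¬ p covers x → x ∈ D ∖ p
  ∈-∖⁺ = ∈-filter⁺ (¬? ∘ covers? _)

  ∈-∖⁻ : ∀ {D p x} → x ∈ D ∖ p → x ∈ D × ¬ p covers x
  ∈-∖⁻ {D} = ∈-filter⁻ (¬? ∘ covers? _) {xs = D}

  ∈-∖∥⁺ : ∀ {D f x} → x ∈ D → ¬ Parallel x f → x ∈ D ∖∥ f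
  ∈-∖∥⁺ = ∈-filter⁺ (λ x → ¬? (parallel? x _))

  ∈-∖∥⁻ : ∀ {D f x} → x ∈ D ∖∥ f → x ∈ D × ¬ Parallel x f
  ∈-∖∥⁻ {D} = ∈-filter⁻ (λ x → ¬? (parallel? x _)) {xs = D}

  independent-≡ : ∀ {M} → AllPairs Independent M → ∀ c {m g} → m ∈ M → g ∈ M → R c m g → m ≡ g
  independent-≡ (_ ∷ _)  c (here refl) (here refl) _ = refl
  independent-≡ (i ∷ _)  c (here refl) (there g∈)  h = ⊥-elim (All.lookup i g∈ c h)
  independent-≡ (i ∷ _)  c (there m∈)  (here refl) h = ⊥-elim (All.lookup i m∈ c (R-sym c h))
  independent-≡ (_ ∷ is) c (there m∈)  (there g∈)  h = independent-≡ is c m∈ g∈ h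

  classSize≤1 : ∀ {M} → AllPairs Independent M → ∀ p → classSize M p ≤ 1
  classSize≤1 ind (c , r) = count≤1 (covers? (c , r)) (λ h h′ i → i c (R-trans c (R-sym c h) h′)) ind

  -- Each class meets M at most once, and the idle class p not at all.
  independent<cover : ∀ {M C p} → AllPairs Independent M → (∀ {m} → m ∈ M → Covers C m) →
                      p ∈ C → (∀ {m} → m ∈ M → ¬ p covers m) → length M < length C
  independent<cover {M} {C} {p} ind cov p∈ idle = begin-strict
    length M                                 ≡⟨ ∑1≡length M ⟨
    ∑[ m ← M ] 1                             ≤⟨ ∑-mono M (λ m∈ → count≥1 (λ q → covers? q _) (cov m∈)) ⟩
    ∑[ m ← M ] count (λ q → covers? q m) C   ≡⟨ ∑-comm M C (λ m q → indicator (covers? q m)) ⟩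
    ∑[ q ← C ] classSize M q                 <⟨ ∑-mono-< C (λ {q} _ → classSize≤1 ind q) p∈ p-idle ⟩
    ∑[ q ← C ] 1                             ≡⟨ ∑1≡length C ⟩
    length C                                 ∎
    where
    open ≤-Reasoning
    p-idle : classSize M p < 1
    p-idle = s≤s (≤-reflexive (count≡0 (covers? p) M idle))

  cover-parallel-class : ∀ {D f} → (P : KönigPair (D ∖∥ f)) → Covers (KönigPair.cover P) f → KönigPair D
  cover-parallel-class {D} {f} P covers-f = record
    { matching = matching ; cover = cover ; independent = independent ; cover≤matching = cover≤matching
    ; matching⊆ = proj₁ ∘ ∈-∖∥⁻ {D} ∘ matching⊆
    ; covers = covers-D }
    where
    open KönigPair P
    covers-D : ∀ {u} → u ∈ D → Covers cover u
    covers-D {u} u∈ with parallel? u f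
    ... | yes par  = covers-parallel covers-f (λ c → R-sym c (par c))
    ... | no ¬par = covers (∈-∖∥⁺ u∈ ¬par)

  Cell : Colour → X → X → X → Set
  Cell c a b y = (c , a) covers y × (other c , b) covers y

  cell? : ∀ c a b → Decidable₁ (Cell c a b)
  cell? c a b y = covers? (c , a) y ×-dec covers? (other c , b) y

  cell≤1 : ∀ {D} → NonParallel D → ∀ c a b → count (cell? c a b) D ≤ 1
  cell≤1 apart c a b = count≤1 (cell? c a b) (λ (h₁ , h₂) (k₁ , k₂) ¬par →
    ¬par (parallel-from c (R-trans c (R-sym c h₁) k₁) (R-trans (other c) (R-sym (other c) h₂) k₂))) apart

  module _ {D k} (uniform : Uniform D k) where

    classSize-uniform : ∀ p → classSize D p ≤ k
    classSize-uniform (c , r) with any? (covers? (c , r)) D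
    ... | no none = ≤-trans (≤-reflexive (count≡0 (covers? (c , r)) D (λ y∈ h → none (lose y∈ h)))) z≤n
    ... | yes some with find some
    ... | y , y∈ , r~y = ≤-reflexive (trans (∑-cong D same-class) (uniform c y∈))
      where
      same-class : ∀ {x} → x ∈ D → indicator (R? c r x) ≡ indicator (R? c y x)
      same-class {x} _ = indicator-cong (R? c r x) (R? c y x) (R-trans c (R-sym c r~y)) (R-trans c r~y)

    -- Each element of D lies in the class of exactly one representative, and each class has k elements.
    length-representatives : ∀ c → length (deduplicate (R? c) D) * k ≡ length D
    length-representatives c = begin
      length L * k                             ≡⟨ ∑-const L k ⟨
      ∑[ l ← L ] k                             ≡⟨ ∑-cong L (λ l∈ → uniform c (∈-deduplicate⁻ (R? c) D l∈)) ⟨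
      ∑[ l ← L ] classSize D (c , l)           ≡⟨ ∑-comm L D (λ l y → indicator (R? c l y)) ⟩
      ∑[ y ← D ] count (λ l → R? c l y) L      ≡⟨ ∑-cong D one-representative ⟩
      ∑[ y ← D ] 1                             ≡⟨ ∑1≡length D ⟩
      length D                                 ∎
      where
      open ≡-Reasoning
      L = deduplicate (R? c) D
      one-representative : ∀ {y} → y ∈ D → count (λ l → R? c l y) L ≡ 1
      one-representative {y} y∈ = ≤-antisym
        (count≤1 (λ l → R? c l y) (λ h h′ ¬r → ¬r (R-trans c h (R-sym c h′))) (deduplicate-apart (R? c) D))
        (count≥1 (λ l → R? c l y)
          (Any.deduplicate⁺ (R? c) (λ b~a a~y → R-trans c b~a a~y) (lose y∈ (R-refl c))))

  uniform-or-irregular : ∀ D → Uniform D 2 ⊎ ∃[ c ] ∃[ e ] e ∈ D × classSize D (c , e) ≢ 2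
  uniform-or-irregular D
    with any? (λ x → ¬? (classSize D (red , x) ≟ 2) ⊎-dec ¬? (classSize D (blue , x) ≟ 2)) D
  ... | yes some with find some
  ... | e , e∈ , inj₁ irregular = inj₂ (red  , e , e∈ , irregular)
  ... | e , e∈ , inj₂ irregular = inj₂ (blue , e , e∈ , irregular)
  uniform-or-irregular D | no none = inj₁ λ c {x} x∈ →
    decidable-stable (classSize D (c , x) ≟ 2) (λ irregular → none (lose x∈ (irregular-at c irregular)))
    where
    irregular-at : ∀ c {x} → classSize D (c , x) ≢ 2 →
                   classSize D (red , x) ≢ 2 ⊎ classSize D (blue , x) ≢ 2
    irregular-at red  = inj₁
    irregular-at blue = inj₂

  module IrregularStep {D} (apart : NonParallel D) (below : Below D)
                       (c : Colour) {e} (e∈D : e ∈ D) (irregular : classSize D (c , e) ≢ 2) where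

    c′ : Colour
    c′ = other c

    P₁ : KönigPair (D ∖ (c′ , e))
    P₁ = below (∖-shorter c′ e∈D)

    open KönigPair P₁ renaming
      (matching to M₁; cover to C₁; matching⊆ to M₁⊆; independent to M₁-independent;
       covers to C₁-covers; cover≤matching to C₁≤M₁)

    M₁⊆D : M₁ ⊆ D
    M₁⊆D = proj₁ ∘ ∈-∖⁻ {D} ∘ M₁⊆

    M₁-outside : ∀ {m} → m ∈ M₁ → ¬ (c′ , e) covers m
    M₁-outside = proj₂ ∘ ∈-∖⁻ {D} ∘ M₁⊆

    C₀ : List Class
    C₀ = (c′ , e) ∷ C₁

    C₀-covers : ∀ {u} → u ∈ D → Covers C₀ u
    C₀-covers {u} u∈ with covers? (c′ , e) u
    ... | yes h = here h
    ... | no h  = there (C₁-covers (∈-∖⁺ u∈ h))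

    add-e : (∀ {m} → m ∈ M₁ → ¬ (c , e) covers m) → KönigPair D
    add-e outside = record
      { matching = e ∷ M₁ ; cover = C₀ ; covers = C₀-covers ; cover≤matching = s≤s C₁≤M₁
      ; matching⊆ = λ { (here refl) → e∈D ; (there m∈) → M₁⊆D m∈ }
      ; independent = All.tabulate e-independent ∷ M₁-independent }
      where
      e-independent : ∀ {m} → m ∈ M₁ → Independent e m
      e-independent m∈ d with same-or-other c d
      ... | inj₁ refl = outside m∈
      ... | inj₂ refl = M₁-outside m∈

    -- The class (c , e) contains e and g; if it had no third element outside the c′-classes of e and g,
    -- it would have exactly two elements, as each cell contains at most one element of D.
    third-member : ∀ {g} → g ∈ M₁ → (c , e) covers g →
                   ∃[ f ] f ∈ D × (c , e) covers f × ¬ (c′ , e) covers f × ¬ (c′ , g) covers f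
    third-member {g} g∈ e~g
      with any? (λ x → covers? (c , e) x ×-dec ¬? (covers? (c′ , e) x) ×-dec ¬? (covers? (c′ , g) x)) D
    ... | yes found = find found
    ... | no none   = ⊥-elim (irregular (≤-antisym at-most-two at-least-two))
      where
      e≢g : e ≢ g
      e≢g refl = M₁-outside g∈ (R-refl c′)

      at-least-two : 2 ≤ classSize D (c , e)
      at-least-two = count≥2 (covers? (c , e)) e∈D (M₁⊆D g∈) e≢g (R-refl c) e~g

      in-two-cells : ∀ {y} → y ∈ D → (c , e) covers y → Cell c e e y ⊎ Cell c e g y
      in-two-cells {y} y∈ e~y with covers? (c′ , e) y | covers? (c′ , g) y
      ... | yes e~′y | _        = inj₁ (e~y , e~′y)
      ... | no _     | yes g~′y = inj₂ (e~y , g~′y)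
      ... | no e≁′y  | no g≁′y  = ⊥-elim (none (lose y∈ (e~y , e≁′y , g≁′y)))

      at-most-two : classSize D (c , e) ≤ 2
      at-most-two = ≤-trans (count-⊎ (covers? (c , e)) (cell? c e e) (cell? c e g) D in-two-cells)
                            (+-mono-≤ (cell≤1 apart c e e) (cell≤1 apart c e g))

    module _ {g f} (g∈M₁ : g ∈ M₁) (e~g : (c , e) covers g) (f∈D : f ∈ D) (e~f : (c , e) covers f)
             (e≁′f : ¬ (c′ , e) covers f) (g≁′f : ¬ (c′ , g) covers f) where

      P₂ : KönigPair (D ∖∥ f)
      P₂ = below (∖∥-shorter f∈D)

      open KönigPair P₂ renaming
        (matching to M₂; cover to C₂; matching⊆ to M₂⊆; independent to M₂-independent;
         covers to C₂-covers; cover≤matching to C₂≤M₂)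

      M₁⊆D∖∥f : M₁ ⊆ D ∖∥ f
      M₁⊆D∖∥f {m} m∈ = ∈-∖∥⁺ (M₁⊆D m∈) m∦f
        where
        m∦f : ¬ Parallel m f
        m∦f m∥f with independent-≡ M₁-independent c g∈M₁ m∈
                       (R-trans c (R-sym c e~g) (R-trans c e~f (R-sym c (m∥f c))))
        ... | refl = g≁′f (m∥f c′)

      e∈D∖∥f : e ∈ D ∖∥ f
      e∈D∖∥f = ∈-∖∥⁺ e∈D (λ e∥f → e≁′f (e∥f c′))

      -- The class of C₂ covering e cannot have colour c (it would cover f), so it has colour c′
      -- and is idle on M₁.
      M₁<C₂ : ¬ Covers C₂ f → length M₁ < length C₂
      M₁<C₂ C₂∤f with find (C₂-covers e∈D∖∥f)
      ... | (d , r) , p∈ , r~e with same-or-other c d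
      ... | inj₁ refl = ⊥-elim (C₂∤f (lose p∈ (R-trans c r~e e~f)))
      ... | inj₂ refl = independent<cover M₁-independent (C₂-covers ∘ M₁⊆D∖∥f) p∈
                          (λ m∈ r~m → M₁-outside m∈ (R-trans c′ (R-sym c′ r~e) r~m))

      exchange : KönigPair D
      exchange with any? (λ p → covers? p f) C₂
      ... | yes C₂f = cover-parallel-class P₂ C₂f
      ... | no C₂∤f = record
        { matching = M₂ ; cover = C₀ ; independent = M₂-independent ; covers = C₀-covers
        ; matching⊆ = proj₁ ∘ ∈-∖∥⁻ {D} ∘ M₂⊆
        ; cover≤matching = ≤-trans (s≤s C₁≤M₁) (≤-trans (M₁<C₂ C₂∤f) C₂≤M₂) }

    result : KönigPair D
    result with any? (covers? (c , e)) M₁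
    ... | no none = add-e (λ m∈ h → none (lose m∈ h))
    ... | yes some with find some
    ... | g , g∈ , e~g with third-member g∈ e~g
    ... | f , f∈ , e~f , e≁′f , g≁′f = exchange g∈ e~g f∈ e~f e≁′f g≁′f

  -- Every vertex of the multigraph has degree 2, so it is a union of even cycles and the red
  -- classes alone form a cover of half the size of D.
  module UniformStep {D} (apart : NonParallel D) (below : Below D) (uniform : Uniform D 2)
                     {e} (e∈D : e ∈ D) where

    open KönigPair (below {D ∖∥ e} (∖∥-shorter e∈D)) renaming
      (matching to M₂; cover to C₂; matching⊆ to M₂⊆; independent to M₂-independent;
       covers to C₂-covers; cover≤matching to C₂≤M₂)

    L : List X
    L = deduplicate (R? red) D

    C : List Class
    C = map (red ,_) L

    C-covers : ∀ {u} → u ∈ D → Covers C u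
    C-covers u∈ = Any.map⁺ (Any.map (R-sym red)
      (Any.deduplicate⁺ (R? red) (λ y~x u~x → R-trans red u~x (R-sym red y~x)) (lose u∈ (R-refl red))))

    -- Apart from the elements parallel to e (at most one), D is covered by C₂.
    D≤1+C₂*2 : length D ≤ 1 + length C₂ * 2
    D≤1+C₂*2 = begin
      length D                                                       ≡⟨ ∑1≡length D ⟨
      ∑[ y ← D ] 1                                                   ≤⟨ ∑-mono D parallel-or-covered ⟩
      ∑[ y ← D ] (indicator (parallel? y e) + count (λ p → covers? p y) C₂)  ≡⟨ ∑-+ D ⟩
      count (λ y → parallel? y e) D + ∑[ y ← D ] count (λ p → covers? p y) C₂
        ≡⟨ cong (count (λ y → parallel? y e) D +_) (∑-comm D C₂ (λ y p → indicator (covers? p y))) ⟩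
      count (λ y → parallel? y e) D + ∑[ p ← C₂ ] classSize D p
        ≤⟨ +-mono-≤ parallel≤1 (∑-mono C₂ (λ {p} _ → classSize-uniform uniform p)) ⟩
      1 + ∑[ p ← C₂ ] 2                                              ≡⟨ cong suc (∑-const C₂ 2) ⟩
      1 + length C₂ * 2                                              ∎
      where
      open ≤-Reasoning
      parallel-or-covered : ∀ {y} → y ∈ D → 1 ≤ indicator (parallel? y e) + count (λ p → covers? p y) C₂
      parallel-or-covered {y} y∈ with parallel? y e
      ... | yes _   = s≤s z≤n
      ... | no y∦e = count≥1 (λ p → covers? p y) (C₂-covers (∈-∖∥⁺ y∈ y∦e))
      parallel≤1 : count (λ y → parallel? y e) D ≤ 1
      parallel≤1 = count≤1 (λ y → parallel? y e)
        (λ x∥e y∥e x∦y → x∦y (λ c → R-trans c (x∥e c) (R-sym c (y∥e c)))) apart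

    L≤C₂ : length L ≤ length C₂
    L≤C₂ = s≤s⁻¹ (*-cancelʳ-< 2 (length L) (suc (length C₂))
             (s≤s (≤-trans (≤-reflexive (length-representatives uniform red)) D≤1+C₂*2)))

    result : KönigPair D
    result = record
      { matching = M₂ ; cover = C ; independent = M₂-independent ; covers = C-covers
      ; matching⊆ = proj₁ ∘ ∈-∖∥⁻ {D} ∘ M₂⊆
      ; cover≤matching = ≤-trans (≤-reflexive (length-map {A = X} (red ,_) L)) (≤-trans L≤C₂ C₂≤M₂) }

  nonParallel-königPair : ∀ {D} → NonParallel D → Below D → KönigPair D
  nonParallel-königPair {[]} _ _ = record
    { matching = [] ; cover = [] ; matching⊆ = λ () ; independent = [] ; covers = λ () ; cover≤matching = z≤n }
  nonParallel-königPair {D@(e ∷ _)} apart below with uniform-or-irregular D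
  ... | inj₁ uniform                   = UniformStep.result apart below uniform (here refl)
  ... | inj₂ (c , x , x∈ , irregular) = IrregularStep.result apart below c x∈ irregular

  königPair : ∀ U → KönigPair U
  königPair = WellFounded.All.wfRec (On.wellFounded length <-wellFounded) 0ℓ KönigPair deduplicated-pair
    where
    deduplicated-pair : ∀ U → Below U → KönigPair U
    deduplicated-pair U below = record
      { matching = matching ; cover = cover ; independent = independent ; cover≤matching = cover≤matching
      ; matching⊆ = ∈-deduplicate⁻ parallel? U ∘ matching⊆
      ; covers = covers-U }
      where
      D = deduplicate parallel? U
      open KönigPair (nonParallel-königPair (deduplicate-apart parallel? U)
                        (λ shorter → below (≤-trans shorter (length-deduplicate parallel? U))))
      covers-U : ∀ {u} → u ∈ U → Covers cover u
      covers-U u∈ with find (Any.deduplicate⁺ parallel? (λ y∥x u∥x c → R-trans c (u∥x c) (R-sym c (y∥x c)))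
                                                  (lose u∈ (λ c → R-refl c)))
      ... | d , d∈ , u∥d = covers-parallel (covers d∈) (λ c → R-sym c (u∥d c))

_≟ᶜ_ : (c d : Colour) → Dec (c ≡ d)
red  ≟ᶜ red  = yes refl
red  ≟ᶜ blue = no λ ()
blue ≟ᶜ red  = no λ ()
blue ≟ᶜ blue = yes refl

no-room : ∀ t d N → d + suc t * 2 ≤ N → suc t * N ≤ suc t * d + suc t * (2 * t + 1) → ⊥
no-room t d N small large = <-irrefl refl (≤-trans (≤-reflexive 2t+2≡) 2t+2≤2t+1)
  where
  2t+2≡ : suc (2 * t + 1) ≡ suc t * 2
  2t+2≡ = cong suc (trans (+-comm (2 * t) 1) (cong suc (*-comm 2 t)))
  2t+2≤2t+1 : suc t * 2 ≤ 2 * t + 1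
  2t+2≤2t+1 = *-cancelˡ-≤ (suc t) (+-cancelˡ-≤ (suc t * d) _ _ (begin
    suc t * d + suc t * (suc t * 2) ≡⟨ *-distribˡ-+ (suc t) d (suc t * 2) ⟨
    suc t * (d + suc t * 2)         ≤⟨ *-monoʳ-≤ (suc t) small ⟩
    suc t * N                       ≤⟨ large ⟩
    suc t * d + suc t * (2 * t + 1) ∎))
    where open ≤-Reasoning

module Monochromatic {n : ℕ} (G : Graph n) (χ : TwoColouring G) where

  reach-trans : ∀ {c r u w} → Reach G χ c r u → Reach G χ c u w → Reach G χ c r w
  reach-trans r~u here            = r~u
  reach-trans r~u (step u~v e k) = step (reach-trans r~u u~v) e k

  reach-sym : ∀ {c r w} → Reach G χ c r w → Reach G χ c w r
  reach-sym here                       = here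
  reach-sym (step {u} {w} r~u e k) =
    reach-trans (step here (trans (adj-sym G w u) e) (trans (colSym χ w u) k)) (reach-sym r~u)

  reach-isEquivalence : ∀ c → IsEquivalence (Reach G χ c)
  reach-isEquivalence c = record { refl = here ; sym = reach-sym ; trans = reach-trans }

  Edge : Colour → Rel (Fin n) 0ℓ
  Edge c u w = adj G u w ≡ true × col χ u w ≡ c

  reach⇒star : ∀ {c r w} → Reach G χ c r w → Star (Edge c) r w
  reach⇒star here           = ε
  reach⇒star (step r~u e k) = reach⇒star r~u ◅◅ ((e , k) ◅ ε)

  star⇒reach : ∀ {c r w} → Star (Edge c) r w → Reach G χ c r w
  star⇒reach ε               = here
  star⇒reach ((e , k) ◅ u~w) = reach-trans (step here e k) (star⇒reach u~w)

  reach? : ∀ c → Decidable (Reach G χ c)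
  reach? c r = map′ star⇒reach reach⇒star ∘ star? (λ u w → adj G u w Bool.≟ true ×-dec col χ u w ≟ᶜ c) r

  open König (Reach G χ) reach? reach-isEquivalence public

  -- weight v w is 2 if w = v and 1 if w is a neighbour of v; in either case v lies in at least that
  -- many of the two components of w.
  weight : Fin n → Fin n → ℕ
  weight v w = indicator (T? (adj G v w)) + 2 * indicator (v ≟ᶠ w)

  weight≤ : ∀ v w → weight v w ≤ indicator (reach? red w v) + indicator (reach? blue w v)
  weight≤ v w with v ≟ᶠ w
  ... | yes refl rewrite irrefl G v =
    +-mono-≤ (indicator-mono (yes here) (reach? red v v) id) (indicator-mono (yes here) (reach? blue v v) id)
  ... | no _ with adj G v w in e
  ... | false = z≤n
  ... | true with col χ v w in k
  ... | red  = ≤-trans (indicator-mono (yes (reach-sym (step here e k))) (reach? red w v) id) (m≤m+n _ _)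
  ... | blue = ≤-trans (indicator-mono (yes (reach-sym (step here e k))) (reach? blue w v) id) (m≤n+m _ _)

  ∑-weight : ∀ v → ∑[ w ← allFin n ] weight v w ≡ degree G v + 2
  ∑-weight v = begin
    ∑[ w ← allFin n ] weight v w                                         ≡⟨ ∑-+ (allFin n) ⟩
    count (T? ∘ adj G v) (allFin n) + ∑[ w ← allFin n ] (2 * indicator (v ≟ᶠ w))
      ≡⟨ cong₂ _+_ (count≡length-filter (T? ∘ adj G v) (allFin n))
                   (∑-*ˡ (allFin n) 2 (indicator ∘ (v ≟ᶠ_))) ⟩
    degree G v + 2 * count (v ≟ᶠ_) (allFin n)
      ≡⟨ cong (λ k → degree G v + 2 * k) v-once ⟩
    degree G v + 2                                                       ∎
    where
    open ≡-Reasoning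
    v-once : count (v ≟ᶠ_) (allFin n) ≡ 1
    v-once = ≤-antisym (count≤1 (v ≟ᶠ_) (λ v≡x v≡y x≢y → x≢y (trans (sym v≡x) v≡y)) (allFin⁺ n))
                       (count≥1 (v ≟ᶠ_) (lose (∈-allFin v) refl))

  independent-degrees : ∀ {S} → AllPairs Independent S → ∑[ v ← S ] (degree G v + 2) ≤ 2 * n
  independent-degrees {S} independent = begin
    ∑[ v ← S ] (degree G v + 2)                    ≡⟨ ∑-cong S (λ {v} _ → ∑-weight v) ⟨
    ∑[ v ← S ] ∑[ w ← allFin n ] weight v w        ≡⟨ ∑-comm S (allFin n) weight ⟩
    ∑[ w ← allFin n ] ∑[ v ← S ] weight v w        ≤⟨ ∑-mono (allFin n) (λ {w} _ → column w) ⟩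
    ∑[ w ← allFin n ] 2                            ≡⟨ ∑-const (allFin n) 2 ⟩
    length (allFin n) * 2                          ≡⟨ cong (_* 2) (length-tabulate {n = n} id) ⟩
    n * 2                                          ≡⟨ *-comm n 2 ⟩
    2 * n                                          ∎
    where
    open ≤-Reasoning
    column : ∀ w → ∑[ v ← S ] weight v w ≤ 2
    column w = begin
      ∑[ v ← S ] weight v w                           ≤⟨ ∑-mono S (λ {v} _ → weight≤ v w) ⟩
      ∑[ v ← S ] (indicator (reach? red w v) + indicator (reach? blue w v)) ≡⟨ ∑-+ S ⟩
      classSize S (red , w) + classSize S (blue , w) ≤⟨ +-mono-≤ (classSize≤1 independent (red , w))
                                                                 (classSize≤1 independent (blue , w)) ⟩
      2                                               ∎

  module _ {t} (δ-bound : ∀ v → 2 * n ≤ suc t * degree G v + (2 * t + 1)) where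

    no-independent-of-size : ∀ {S} → AllPairs Independent S → length S ≡ suc t → ⊥
    no-independent-of-size {S} independent |S|≡ = no-room t (∑[ v ← S ] degree G v) (2 * n) small large
      where
      small : ∑[ v ← S ] degree G v + suc t * 2 ≤ 2 * n
      small = begin
        ∑[ v ← S ] degree G v + suc t * 2             ≡⟨ cong (λ k → ∑[ v ← S ] degree G v + k * 2) |S|≡ ⟨
        ∑[ v ← S ] degree G v + length S * 2          ≡⟨ cong (∑[ v ← S ] degree G v +_) (∑-const S 2) ⟨
        ∑[ v ← S ] degree G v + ∑[ v ← S ] 2          ≡⟨ ∑-+ S ⟨
        ∑[ v ← S ] (degree G v + 2)                   ≤⟨ independent-degrees independent ⟩
        2 * n                                         ∎
        where open ≤-Reasoning
      large : suc t * (2 * n) ≤ suc t * ∑[ v ← S ] degree G v + suc t * (2 * t + 1)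
      large = begin
        suc t * (2 * n)                               ≡⟨ cong (_* (2 * n)) |S|≡ ⟨
        length S * (2 * n)                            ≡⟨ ∑-const S (2 * n) ⟨
        ∑[ v ← S ] (2 * n)                            ≤⟨ ∑-mono S (λ {v} _ → δ-bound v) ⟩
        ∑[ v ← S ] (suc t * degree G v + (2 * t + 1)) ≡⟨ ∑-+ S ⟩
        ∑[ v ← S ] (suc t * degree G v) + ∑[ v ← S ] (2 * t + 1)
          ≡⟨ cong₂ _+_ (∑-*ˡ S (suc t) (degree G))
                       (trans (∑-const S (2 * t + 1)) (cong (_* (2 * t + 1)) |S|≡)) ⟩
        suc t * ∑[ v ← S ] degree G v + suc t * (2 * t + 1) ∎
        where open ≤-Reasoning

    independent-length≤ : ∀ {S} → AllPairs Independent S → length S ≤ t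
    independent-length≤ {S} independent with suc t ≤? length S
    ... | no  short = s≤s⁻¹ (≰⇒> short)
    ... | yes long  = ⊥-elim (no-independent-of-size (AllPairs.take⁺ (suc t) independent)
                                (trans (length-take (suc t) S) (m≤n⇒m⊓n≡m long)))

proposition1p4 : (t n : ℕ) → 1 ≤ t → (G : Graph n) → (χ : TwoColouring G) →
    (∀ v → 2 * n ≤ suc t * degree G v + (2 * t + 1)) →
    CoverableBy G χ t
proposition1p4 t n _ G χ δ-bound =
  cover , ≤-trans cover≤matching (independent-length≤ δ-bound independent) , covered
  where
  open Monochromatic G χ
  open KönigPair (königPair (allFin n))
  covered : ∀ v → ∃[ c ] ∃[ r ] (((c , r) ∈ cover) × Component G χ c r v)
  covered v with find (covers (∈-allFin v))
  ... | (c , r) , p∈ , r~v = c , r , p∈ , r~v
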